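{- For every integer $n \ge 1$, let $a_n$ be the number of ordered pairs $(f,g)$ of polynomials in $\mathbb{F}_2[x]$ such that $f$ and $g$ both have degree exactly $n$, both have constant term equal to $1$, and $\gcd(f,g) = 1$. Then $$a_n = \sum_{k=2}^{n} 2^{n-k} \binom{n-1}{k-1} \frac{2^k + 2\cdot(-1)^k}{3} = 2 \cdot \frac{4^{n-1} - 1}{3}.$$
   Context: $\mathbb{F}_2$ is the field with two elements. Note that a polynomial of degree exactly $n$ over $\mathbb{F}_2$ is automatically monic. -}

module Defs where

open import Data.Bool using (Bool; true; false; _xor_; _∧_)
open import Data.Nat as ℕ using (ℕ; zero; suc; _∸_; _<_)
open import Data.Nat.Combinatorics using (_C_)
open import Data.Integer as ℤ using (ℤ; +_; -1ℤ; 0ℤ; _-_)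
open import Data.List using (List; []; _∷_; map; foldr; upTo; length)
open import Data.Vec using (Vec; toList)
open import Data.Product using (Σ; _×_; _,_)
open import Data.List.Relation.Unary.Unique.Propositional using (Unique)
open import Data.List.Membership.Propositional using (_∈_)
open import Function.Bundles using (_⇔_)
open import Relation.Binary.PropositionalEquality using (_≡_)

-- Polynomials over F₂ = Bool (false = 0, true = 1, _xor_ = +, _∧_ = ·),
-- represented by coefficient lists, lowest degree first.
-- Trailing zero coefficients are allowed; equality is coefficientwise.
Poly : Set
Poly = List Bool

coeff : Poly → ℕ → Bool
coeff []       _       = false
coeff (a ∷ p)  zero    = a
coeff (a ∷ p)  (suc i) = coeff p i

_≈ₚ_ : Poly → Poly → Set
p ≈ₚ q = ∀ i → coeff p i ≡ coeff q i

_+ₚ_ : Poly → Poly → Poly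
[]      +ₚ q       = q
(a ∷ p) +ₚ []      = a ∷ p
(a ∷ p) +ₚ (b ∷ q) = (a xor b) ∷ (p +ₚ q)

scale : Bool → Poly → Poly
scale a p = map (a ∧_) p

_*ₚ_ : Poly → Poly → Poly
[]      *ₚ q = []
(a ∷ p) *ₚ q = scale a q +ₚ (false ∷ (p *ₚ q))

oneₚ : Poly
oneₚ = true ∷ []

_∣ₚ_ : Poly → Poly → Set
d ∣ₚ f = Σ Poly (λ h → f ≈ₚ (d *ₚ h))

Coprimeₚ : Poly → Poly → Set
Coprimeₚ f g = ∀ d → d ∣ₚ f → d ∣ₚ g → d ∣ₚ oneₚ

HasDegree : ℕ → Poly → Set
HasDegree n f = (coeff f n ≡ true) × (∀ i → n < i → coeff f i ≡ false)

ConstOne : Poly → Set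
ConstOne f = coeff f 0 ≡ true

-- The condition on a pair, for pairs given by coefficient vectors of length n+1
-- (every polynomial of degree exactly n has a unique such vector).
Good : (n : ℕ) → Vec Bool (suc n) × Vec Bool (suc n) → Set
Good n (u , v) =
  HasDegree n (toList u) × HasDegree n (toList v) ×
  ConstOne (toList u) × ConstOne (toList v) ×
  Coprimeₚ (toList u) (toList v)

-- "the number of such pairs is a": there is a duplicate-free list
-- enumerating exactly the good pairs, of length a.
CountIs : (n : ℕ) → ℕ → Set
CountIs n a = Σ (List (Vec Bool (suc n) × Vec Bool (suc n))) λ L →
  Unique L × (∀ p → (p ∈ L) ⇔ Good n p) × (length L ≡ a)

-- Integer sum Σ_{k=2}^{n} t k
sumFrom2 : ℕ → (ℕ → ℤ) → ℤ
sumFrom2 n t = foldr ℤ._+_ 0ℤ (map (λ i → t (suc (suc i))) (upTo (n ∸ 1)))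

-- (2^k + 2·(-1)^k) / 3  (exact division)
J : ℕ → ℤ
J k = ((+ 2) ℤ.^ k ℤ.+ (+ 2) ℤ.* (-1ℤ ℤ.^ k)) ℤ./ (+ 3)

middleSum : ℕ → ℤ
middleSum n = sumFrom2 n λ k → (+ 2) ℤ.^ (n ∸ k) ℤ.* (+ ((n ∸ 1) C (k ∸ 1))) ℤ.* J k

-- 2 (4^{n-1} - 1) / 3  (exact division)
closedForm : ℕ → ℤ
closedForm n = (+ 2) ℤ.* (((+ 4) ℤ.^ (n ∸ 1) - (+ 1)) ℤ./ (+ 3))

-- Write 1 + x s for a polynomial over F₂ with constant term 1. Let E(a, b) count the coprime pairs
-- (1 + x s, 1 + x t) with deg s < a, deg t < b, and D(b, a) the coprime pairs (1 + x t, u) with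
-- deg t < b, deg u < a. As 1 + x t is prime to x, splitting u by its constant term gives
-- D(b, a + 1) = D(b, a) + E(b, a), and D(b, 0) = 1 since only 1 is prime to 0. One Euclid step,
-- gcd(1 + x s, 1 + x t) = gcd(1 + x t, s + t), gives E(a, b) = D(b, a) for b ≤ a, because s ↦ s + t
-- permutes the s. Together, E(n + 1, n + 1) + 1 = 4 E(n, n), so E(n, n) = 2 (4ⁿ − 1)/3 + 1, and
-- inclusion–exclusion over the leading coefficients gives a(n + 1) = E(n, n) − 1 = 2 (4ⁿ − 1)/3.
-- For the sum, 3 J(k) = 2ᵏ + 2 (−1)ᵏ turns it into 2 ((2 + 2)ⁿ⁻¹ − (−1 + 2)ⁿ⁻¹) by the binomial theorem.

module Submission where

open import Defs
open import Data.Bool as Bool using (Bool; true; false; _xor_; _∧_)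
open import Data.Bool.Properties using (xor-identityʳ; xor-assoc; xor-comm; xor-same; ∧-zeroʳ; ∧-identityʳ; ∧-distribˡ-xor)
open import Data.Nat using (ℕ; zero; suc; _+_; _*_; _^_; _∸_; _<_; _≤_; _≥_; s≤s; z≤n; _≤?_)
open import Data.Nat.Properties using (≤-refl; ≤-trans; <⇒≤; ≰⇒>; m≤n+m; +-suc; +-comm; m+n≡0⇒m≡0; +-commutativeSemigroup; n≤1+n; +-cancelˡ-≡; +-cancelʳ-≡; +-identityʳ; *-comm)
open import Data.Nat.Tactic.RingSolver using (solve-∀)
open import Data.Nat.DivMod using (m*n/n≡m)
open import Data.Nat.Combinatorics using (_C_)
open import Data.Nat.ListAction using (sum)
open import Data.Nat.ListAction.Properties using (sum-++)
open import Algebra.Properties.CommutativeSemigroup +-commutativeSemigroup using () renaming (interchange to +-interchange; xy∙z≈xz∙y to +-rightComm)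
open import Data.Integer as ℤ using (ℤ; +_; -1ℤ; 0ℤ)
open import Data.Integer.Properties as ℤ using ()
open import Data.Integer.DivMod using (div-pos-is-/ℕ)
import Data.Integer.Tactic.RingSolver as ℤ-RingSolver
import Algebra.Properties.CommutativeSemiring.Binomial ℤ.+-*-commutativeSemiring as Binomial
open Binomial using (binomialTerm; binomialExpansion)
open import Algebra.Properties.Semiring.Exp ℤ.+-*-semiring using () renaming (_^_ to _^ˢ_)
open import Algebra.Properties.Semiring.Mult ℤ.+-*-semiring using () renaming (_×_ to _×ˢ_)
open import Algebra.Properties.Semiring.Sum ℤ.+-*-semiring using (*-distribˡ-sum; sum-cong-≗) renaming (sum to sumℤ)
open import Data.Fin using (Fin; zero; suc; toℕ)
open import Data.List as List using (List; []; _∷_; length; _++_; filter; cartesianProductWith; cartesianProduct; applyUpTo)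
open import Data.List.Properties using (map-++; map-cong; map-∘; map-upTo)
open import Data.List.Membership.Propositional using (_∈_)
open import Data.List.Membership.Propositional.Properties using (∈-filter⁺; ∈-filter⁻; ∈-cartesianProductWith⁺; ∈-cartesianProduct⁺)
open import Data.List.Relation.Unary.Unique.Propositional using (Unique)
open import Data.List.Relation.Unary.Unique.Propositional.Properties using (cartesianProductWith⁺; cartesianProduct⁺; filter⁺)
open import Data.List.Relation.Unary.AllPairs using ([]; _∷_)
open import Data.List.Relation.Unary.All using ([]; _∷_)
open import Data.List.Relation.Unary.Any using (here; there)
open import Data.Vec using (Vec; []; _∷_; toList; zipWith; _∷ʳ_; padRight; replicate)
open import Data.Product using (Σ; _×_; _,_; proj₁; proj₂)
open import Data.Sum using (_⊎_; inj₁; inj₂; [_,_]′)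
open import Data.Empty using (⊥; ⊥-elim)
open import Function.Bundles using (_⇔_; mk⇔; Equivalence)
open Equivalence using (to; from)
open import Function.Properties.Equivalence using () renaming (sym to ⇔-sym; trans to ⇔-trans)
open import Relation.Nullary using (Dec; yes; no; ¬_)
open import Relation.Nullary.Decidable using (map; _×-dec_)
open import Relation.Binary.PropositionalEquality using (_≡_; refl; sym; trans; cong; cong₂; subst; module ≡-Reasoning)
open ≡-Reasoning

-- Arithmetic in F₂[x]

xor-interchange : ∀ w x y z → (w xor x) xor (y xor z) ≡ (w xor y) xor (x xor z)
xor-interchange w x y z = begin
  (w xor x) xor (y xor z)  ≡⟨ xor-assoc w x (y xor z) ⟩
  w xor (x xor (y xor z))  ≡⟨ cong (w xor_) (sym (xor-assoc x y z)) ⟩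
  w xor ((x xor y) xor z)  ≡⟨ cong (λ b → w xor (b xor z)) (xor-comm x y) ⟩
  w xor ((y xor x) xor z)  ≡⟨ cong (w xor_) (xor-assoc y x z) ⟩
  w xor (y xor (x xor z))  ≡⟨ sym (xor-assoc w y (x xor z)) ⟩
  (w xor y) xor (x xor z)  ∎

true≢false : true ≡ false → ∀ {A : Set} → A
true≢false ()

coeff-+ₚ : ∀ p q i → coeff (p +ₚ q) i ≡ coeff p i xor coeff q i
coeff-+ₚ []      q       i       = refl
coeff-+ₚ (a ∷ p) []      i       = sym (xor-identityʳ _)
coeff-+ₚ (a ∷ p) (b ∷ q) zero    = refl
coeff-+ₚ (a ∷ p) (b ∷ q) (suc i) = coeff-+ₚ p q i

coeff-scale : ∀ a p i → coeff (scale a p) i ≡ a ∧ coeff p i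
coeff-scale a []      i       = sym (∧-zeroʳ a)
coeff-scale a (b ∷ p) zero    = refl
coeff-scale a (b ∷ p) (suc i) = coeff-scale a p i

coeff-∷-*ₚ : ∀ a p q i → coeff ((a ∷ p) *ₚ q) i ≡ (a ∧ coeff q i) xor coeff (false ∷ (p *ₚ q)) i
coeff-∷-*ₚ a p q i = trans (coeff-+ₚ (scale a q) _ i) (cong (_xor _) (coeff-scale a q i))

coeff-*ₚ-zero : ∀ a p q → coeff ((a ∷ p) *ₚ q) 0 ≡ a ∧ coeff q 0
coeff-*ₚ-zero a p q = trans (coeff-∷-*ₚ a p q 0) (xor-identityʳ _)

coeff-*ₚ-suc : ∀ a p q i → coeff ((a ∷ p) *ₚ q) (suc i) ≡ (a ∧ coeff q (suc i)) xor coeff (p *ₚ q) i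
coeff-*ₚ-suc a p q i = coeff-∷-*ₚ a p q (suc i)

coeff₀-*ₚ : ∀ p q → coeff (p *ₚ q) 0 ≡ coeff p 0 ∧ coeff q 0
coeff₀-*ₚ []      q = refl
coeff₀-*ₚ (a ∷ p) q = coeff-*ₚ-zero a p q

+ₚ-cancel : ∀ f g → (f +ₚ (f +ₚ g)) ≈ₚ g
+ₚ-cancel f g i = begin
  coeff (f +ₚ (f +ₚ g)) i            ≡⟨ coeff-+ₚ f (f +ₚ g) i ⟩
  coeff f i xor coeff (f +ₚ g) i     ≡⟨ cong (coeff f i xor_) (coeff-+ₚ f g i) ⟩
  coeff f i xor (coeff f i xor coeff g i) ≡⟨ sym (xor-assoc (coeff f i) _ _) ⟩
  (coeff f i xor coeff f i) xor coeff g i ≡⟨ cong (_xor coeff g i) (xor-same (coeff f i)) ⟩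
  coeff g i                          ∎

∷-cong : ∀ {a p q} → p ≈ₚ q → (a ∷ p) ≈ₚ (a ∷ q)
∷-cong p≈q zero    = refl
∷-cong p≈q (suc i) = p≈q i

*ₚ-congˡ : ∀ p {q q′} → q ≈ₚ q′ → (p *ₚ q) ≈ₚ (p *ₚ q′)
*ₚ-congˡ []      q≈q′ i       = refl
*ₚ-congˡ (a ∷ p) {q} {q′} q≈q′ zero = begin
  coeff ((a ∷ p) *ₚ q) 0  ≡⟨ coeff-*ₚ-zero a p q ⟩
  a ∧ coeff q 0           ≡⟨ cong (a ∧_) (q≈q′ 0) ⟩
  a ∧ coeff q′ 0          ≡⟨ sym (coeff-*ₚ-zero a p q′) ⟩
  coeff ((a ∷ p) *ₚ q′) 0 ∎
*ₚ-congˡ (a ∷ p) {q} {q′} q≈q′ (suc i) = begin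
  coeff ((a ∷ p) *ₚ q) (suc i)                 ≡⟨ coeff-*ₚ-suc a p q i ⟩
  (a ∧ coeff q (suc i)) xor coeff (p *ₚ q) i   ≡⟨ cong₂ (λ b c → (a ∧ b) xor c) (q≈q′ (suc i)) (*ₚ-congˡ p q≈q′ i) ⟩
  (a ∧ coeff q′ (suc i)) xor coeff (p *ₚ q′) i ≡⟨ sym (coeff-*ₚ-suc a p q′ i) ⟩
  coeff ((a ∷ p) *ₚ q′) (suc i)                ∎

*ₚ-zeroˡ : ∀ p q → p ≈ₚ [] → (p *ₚ q) ≈ₚ []
*ₚ-zeroˡ []      q p≈0 i       = refl
*ₚ-zeroˡ (a ∷ p) q p≈0 zero    = trans (coeff-*ₚ-zero a p q) (cong (_∧ coeff q 0) (p≈0 0))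
*ₚ-zeroˡ (a ∷ p) q p≈0 (suc i) =
  trans (coeff-*ₚ-suc a p q i) (cong₂ (λ b c → (b ∧ coeff q (suc i)) xor c) (p≈0 0) (*ₚ-zeroˡ p q (λ j → p≈0 (suc j)) i))

*ₚ-zeroʳ : ∀ p → (p *ₚ []) ≈ₚ []
*ₚ-zeroʳ []      i       = refl
*ₚ-zeroʳ (a ∷ p) zero    = trans (coeff-*ₚ-zero a p []) (∧-zeroʳ a)
*ₚ-zeroʳ (a ∷ p) (suc i) = trans (coeff-*ₚ-suc a p [] i) (cong₂ _xor_ (∧-zeroʳ a) (*ₚ-zeroʳ p i))

*ₚ-identityʳ : ∀ p → (p *ₚ oneₚ) ≈ₚ p
*ₚ-identityʳ []      i       = refl
*ₚ-identityʳ (a ∷ p) zero    = trans (coeff-*ₚ-zero a p oneₚ) (∧-identityʳ a)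
*ₚ-identityʳ (a ∷ p) (suc i) = trans (coeff-*ₚ-suc a p oneₚ i) (trans (cong (_xor coeff (p *ₚ oneₚ) i) (∧-zeroʳ a)) (*ₚ-identityʳ p i))

*ₚ-shiftʳ : ∀ p q → (p *ₚ (false ∷ q)) ≈ₚ (false ∷ (p *ₚ q))
*ₚ-shiftʳ []      q zero    = refl
*ₚ-shiftʳ []      q (suc i) = refl
*ₚ-shiftʳ (a ∷ p) q zero    = trans (coeff-*ₚ-zero a p (false ∷ q)) (∧-zeroʳ a)
*ₚ-shiftʳ (a ∷ p) q (suc i) = begin
  coeff ((a ∷ p) *ₚ (false ∷ q)) (suc i)           ≡⟨ coeff-*ₚ-suc a p (false ∷ q) i ⟩
  (a ∧ coeff q i) xor coeff (p *ₚ (false ∷ q)) i   ≡⟨ cong ((a ∧ coeff q i) xor_) (*ₚ-shiftʳ p q i) ⟩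
  (a ∧ coeff q i) xor coeff (false ∷ (p *ₚ q)) i   ≡⟨ sym (coeff-∷-*ₚ a p q i) ⟩
  coeff ((a ∷ p) *ₚ q) i                           ∎

*ₚ-distribˡ-+ₚ : ∀ p q r → (p *ₚ (q +ₚ r)) ≈ₚ ((p *ₚ q) +ₚ (p *ₚ r))
*ₚ-distribˡ-+ₚ []      q r i = refl
*ₚ-distribˡ-+ₚ (a ∷ p) q r zero = begin
  coeff ((a ∷ p) *ₚ (q +ₚ r)) 0                      ≡⟨ coeff-*ₚ-zero a p (q +ₚ r) ⟩
  a ∧ coeff (q +ₚ r) 0                               ≡⟨ cong (a ∧_) (coeff-+ₚ q r 0) ⟩
  a ∧ (coeff q 0 xor coeff r 0)                      ≡⟨ ∧-distribˡ-xor a (coeff q 0) (coeff r 0) ⟩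
  (a ∧ coeff q 0) xor (a ∧ coeff r 0)                ≡⟨ sym (cong₂ _xor_ (coeff-*ₚ-zero a p q) (coeff-*ₚ-zero a p r)) ⟩
  coeff ((a ∷ p) *ₚ q) 0 xor coeff ((a ∷ p) *ₚ r) 0  ≡⟨ sym (coeff-+ₚ ((a ∷ p) *ₚ q) _ 0) ⟩
  coeff (((a ∷ p) *ₚ q) +ₚ ((a ∷ p) *ₚ r)) 0         ∎
*ₚ-distribˡ-+ₚ (a ∷ p) q r (suc i) = begin
  coeff ((a ∷ p) *ₚ (q +ₚ r)) (suc i)
    ≡⟨ coeff-*ₚ-suc a p (q +ₚ r) i ⟩
  (a ∧ coeff (q +ₚ r) (suc i)) xor coeff (p *ₚ (q +ₚ r)) i
    ≡⟨ cong₂ (λ b c → (a ∧ b) xor c) (coeff-+ₚ q r (suc i)) (trans (*ₚ-distribˡ-+ₚ p q r i) (coeff-+ₚ (p *ₚ q) _ i)) ⟩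
  (a ∧ (qᵢ xor rᵢ)) xor (coeff (p *ₚ q) i xor coeff (p *ₚ r) i)
    ≡⟨ cong (_xor _) (∧-distribˡ-xor a qᵢ rᵢ) ⟩
  ((a ∧ qᵢ) xor (a ∧ rᵢ)) xor (coeff (p *ₚ q) i xor coeff (p *ₚ r) i)
    ≡⟨ xor-interchange (a ∧ qᵢ) (a ∧ rᵢ) _ _ ⟩
  ((a ∧ qᵢ) xor coeff (p *ₚ q) i) xor ((a ∧ rᵢ) xor coeff (p *ₚ r) i)
    ≡⟨ sym (cong₂ _xor_ (coeff-*ₚ-suc a p q i) (coeff-*ₚ-suc a p r i)) ⟩
  coeff ((a ∷ p) *ₚ q) (suc i) xor coeff ((a ∷ p) *ₚ r) (suc i)
    ≡⟨ sym (coeff-+ₚ ((a ∷ p) *ₚ q) _ (suc i)) ⟩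
  coeff (((a ∷ p) *ₚ q) +ₚ ((a ∷ p) *ₚ r)) (suc i) ∎
  where
  qᵢ = coeff q (suc i)
  rᵢ = coeff r (suc i)

∣ₚ-respʳ : ∀ {d f g} → f ≈ₚ g → d ∣ₚ f → d ∣ₚ g
∣ₚ-respʳ f≈g (h , f≈dh) = h , λ i → trans (sym (f≈g i)) (f≈dh i)

∣ₚ-+ₚ : ∀ {d f g} → d ∣ₚ f → d ∣ₚ g → d ∣ₚ (f +ₚ g)
∣ₚ-+ₚ {d} {f} {g} (h , f≈dh) (k , g≈dk) = h +ₚ k , λ i → begin
  coeff (f +ₚ g) i                      ≡⟨ coeff-+ₚ f g i ⟩
  coeff f i xor coeff g i               ≡⟨ cong₂ _xor_ (f≈dh i) (g≈dk i) ⟩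
  coeff (d *ₚ h) i xor coeff (d *ₚ k) i ≡⟨ sym (coeff-+ₚ (d *ₚ h) _ i) ⟩
  coeff ((d *ₚ h) +ₚ (d *ₚ k)) i        ≡⟨ sym (*ₚ-distribˡ-+ₚ d h k i) ⟩
  coeff (d *ₚ (h +ₚ k)) i               ∎

∣ₚ-refl : ∀ f → f ∣ₚ f
∣ₚ-refl f = oneₚ , λ i → sym (*ₚ-identityʳ f i)

∣ₚ-zero : ∀ f → f ∣ₚ []
∣ₚ-zero f = [] , λ i → sym (*ₚ-zeroʳ f i)

∣ₚ-x* : ∀ {d u} → d ∣ₚ u → d ∣ₚ (false ∷ u)
∣ₚ-x* {d} {u} (k , u≈dk) = false ∷ k , λ where
  zero    → sym (*ₚ-shiftʳ d k 0)
  (suc i) → trans (u≈dk i) (sym (*ₚ-shiftʳ d k (suc i)))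

x-factor : ∀ k → coeff k 0 ≡ false → Σ Poly λ k′ → k ≈ₚ (false ∷ k′)
x-factor []      _    = [] , λ where
  zero    → refl
  (suc i) → refl
x-factor (b ∷ k) b≡false = k , λ where
  zero    → b≡false
  (suc i) → refl

∣ₚ-x*-cancel : ∀ {d u} → ConstOne d → d ∣ₚ (false ∷ u) → d ∣ₚ u
∣ₚ-x*-cancel {d} {u} d₀≡true (k , xu≈dk) = k′ , λ i → begin
  coeff u i                         ≡⟨ xu≈dk (suc i) ⟩
  coeff (d *ₚ k) (suc i)            ≡⟨ *ₚ-congˡ d k≈xk′ (suc i) ⟩
  coeff (d *ₚ (false ∷ k′)) (suc i) ≡⟨ *ₚ-shiftʳ d k′ (suc i) ⟩
  coeff (d *ₚ k′) i                 ∎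
  where
  k₀≡false : coeff k 0 ≡ false
  k₀≡false = begin
    coeff k 0              ≡⟨ sym (cong (_∧ coeff k 0) d₀≡true) ⟩
    coeff d 0 ∧ coeff k 0  ≡⟨ sym (coeff₀-*ₚ d k) ⟩
    coeff (d *ₚ k) 0       ≡⟨ sym (xu≈dk 0) ⟩
    false                  ∎
  k′ = proj₁ (x-factor k k₀≡false)
  k≈xk′ = proj₂ (x-factor k k₀≡false)

∣ₚ-constOne : ∀ {d f} → d ∣ₚ f → ConstOne f → ConstOne d
∣ₚ-constOne {d} {f} (k , f≈dk) f₀≡true with coeff d 0 in d₀
... | true  = refl
... | false = true≢false (begin
  true                  ≡⟨ sym f₀≡true ⟩
  coeff f 0             ≡⟨ f≈dk 0 ⟩
  coeff (d *ₚ k) 0      ≡⟨ coeff₀-*ₚ d k ⟩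
  coeff d 0 ∧ coeff k 0 ≡⟨ cong (_∧ coeff k 0) d₀ ⟩
  false                 ∎)

HasDegree-∷ : ∀ {n a p} → HasDegree n p → HasDegree (suc n) (a ∷ p)
HasDegree-∷ (top , vanish) = top , λ where
  (suc i) (s≤s n<i) → vanish i n<i

HasDegree-∷⁻ : ∀ {n a p} → HasDegree (suc n) (a ∷ p) → HasDegree n p
HasDegree-∷⁻ (top , vanish) = top , λ i n<i → vanish (suc i) (s≤s n<i)

HasDegree-resp : ∀ {n p q} → p ≈ₚ q → HasDegree n p → HasDegree n q
HasDegree-resp {n} p≈q (top , vanish) = trans (sym (p≈q n)) top , λ i n<i → trans (sym (p≈q i)) (vanish i n<i)

degree-or-zero : ∀ p → (p ≈ₚ []) ⊎ Σ ℕ (λ n → HasDegree n p)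
degree-or-zero []      = inj₁ (λ _ → refl)
degree-or-zero (a ∷ p) with degree-or-zero p
... | inj₂ (n , dp) = inj₂ (suc n , HasDegree-∷ dp)
degree-or-zero (true ∷ p)  | inj₁ p≈0 = inj₂ (0 , refl , λ where (suc i) _ → p≈0 i)
degree-or-zero (false ∷ p) | inj₁ p≈0 = inj₁ λ where
  zero    → refl
  (suc i) → p≈0 i

*ₚ-identityˡ′ : ∀ {p} q → p ≈ₚ [] → ((true ∷ p) *ₚ q) ≈ₚ q
*ₚ-identityˡ′ {p} q p≈0 zero    = coeff-*ₚ-zero true p q
*ₚ-identityˡ′ {p} q p≈0 (suc i) =
  trans (coeff-*ₚ-suc true p q i) (trans (cong (coeff q (suc i) xor_) (*ₚ-zeroˡ p q p≈0 i)) (xor-identityʳ _))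

HasDegree-*ₚ : ∀ {i j} p q → HasDegree i p → HasDegree j q → HasDegree (i + j) (p *ₚ q)
HasDegree-*ₚ []      q (() , _) _
HasDegree-*ₚ {zero} (a ∷ p) q (refl , vanish) dq =
  HasDegree-resp {p = q} {q = (true ∷ p) *ₚ q} (λ k → sym (*ₚ-identityˡ′ {p} q p≈0 k)) dq
  where
  p≈0 : p ≈ₚ []
  p≈0 k = vanish (suc k) (s≤s z≤n)
HasDegree-*ₚ {suc i} {j} (a ∷ p) q dp dq@(_ , q-vanish) =
  trans (shift (i + j) ≤-refl) (proj₁ ih) , λ where
    (suc k) (s≤s i+j<k) → trans (shift k (<⇒≤ i+j<k)) (proj₂ ih k i+j<k)
  where
  ih : HasDegree (i + j) (p *ₚ q)
  ih = HasDegree-*ₚ p q (HasDegree-∷⁻ dp) dq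
  shift : ∀ k → i + j ≤ k → coeff ((a ∷ p) *ₚ q) (suc k) ≡ coeff (p *ₚ q) k
  shift k i+j≤k = trans (coeff-*ₚ-suc a p q k)
    (cong (_xor coeff (p *ₚ q) k) (trans (cong (a ∧_) (q-vanish (suc k) (s≤s (≤-trans (m≤n+m j i) i+j≤k)))) (∧-zeroʳ a)))

∣ₚ-oneₚ⇒degree-zero : ∀ {d n} → d ∣ₚ oneₚ → HasDegree n d → n ≡ 0
∣ₚ-oneₚ⇒degree-zero {d} {n} (k , one≈dk) dd with degree-or-zero k
... | inj₁ k≈0      = true≢false (trans (one≈dk 0) (trans (*ₚ-congˡ d k≈0 0) (*ₚ-zeroʳ d 0)))
... | inj₂ (j , dk) = m+n≡0⇒m≡0 n (coeff-oneₚ (n + j) (trans (one≈dk (n + j)) (proj₁ (HasDegree-*ₚ d k dd dk))))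
  where
  coeff-oneₚ : ∀ m → coeff oneₚ m ≡ true → m ≡ 0
  coeff-oneₚ zero    _ = refl
  coeff-oneₚ (suc m) ()

isZero? : ∀ p → Dec (p ≈ₚ [])
isZero? p = [ yes , (λ { (n , top , _) → no λ p≈0 → true≢false (trans (sym top) (p≈0 n)) }) ]′ (degree-or-zero p)

-- Coprimality

Coprimeₚ-sym : ∀ {f g} → Coprimeₚ f g → Coprimeₚ g f
Coprimeₚ-sym coprime d d∣g d∣f = coprime d d∣f d∣g

Coprimeₚ-respʳ : ∀ {f g g′} → g ≈ₚ g′ → Coprimeₚ f g → Coprimeₚ f g′
Coprimeₚ-respʳ {f} {g} {g′} g≈g′ coprime d d∣f d∣g′ = coprime d d∣f (∣ₚ-respʳ {d} {g′} {g} (λ i → sym (g≈g′ i)) d∣g′)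

Coprimeₚ-respʳ⇔ : ∀ {f g g′} → g ≈ₚ g′ → Coprimeₚ f g ⇔ Coprimeₚ f g′
Coprimeₚ-respʳ⇔ {f} {g} {g′} g≈g′ = mk⇔ (Coprimeₚ-respʳ {f} {g} {g′} g≈g′) (Coprimeₚ-respʳ {f} {g′} {g} (λ i → sym (g≈g′ i)))

Coprimeₚ-sym⇔ : ∀ {f g} → Coprimeₚ f g ⇔ Coprimeₚ g f
Coprimeₚ-sym⇔ {f} {g} = mk⇔ (Coprimeₚ-sym {f} {g}) (Coprimeₚ-sym {g} {f})

Coprimeₚ-respˡ⇔ : ∀ {f f′ g} → f ≈ₚ f′ → Coprimeₚ f g ⇔ Coprimeₚ f′ g
Coprimeₚ-respˡ⇔ {f} {f′} {g} f≈f′ = ⇔-trans (Coprimeₚ-sym⇔ {f} {g}) (⇔-trans (Coprimeₚ-respʳ⇔ {g} {f} {f′} f≈f′) (Coprimeₚ-sym⇔ {g} {f′}))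

Coprimeₚ-+ₚ⇔ : ∀ {f g} → Coprimeₚ f g ⇔ Coprimeₚ f (f +ₚ g)
Coprimeₚ-+ₚ⇔ {f} {g} = mk⇔
  (λ coprime d d∣f d∣f+g → coprime d d∣f (∣ₚ-respʳ {d} {f +ₚ (f +ₚ g)} {g} (+ₚ-cancel f g) (∣ₚ-+ₚ {d} {f} {f +ₚ g} d∣f d∣f+g)))
  (λ coprime d d∣f d∣g → coprime d d∣f (∣ₚ-+ₚ {d} {f} {g} d∣f d∣g))

Coprimeₚ-x*⇔ : ∀ {f u} → ConstOne f → Coprimeₚ f u ⇔ Coprimeₚ f (false ∷ u)
Coprimeₚ-x*⇔ {f} {u} f₀≡true = mk⇔
  (λ coprime d d∣f d∣xu → coprime d d∣f (∣ₚ-x*-cancel {d} (∣ₚ-constOne {d} {f} d∣f f₀≡true) d∣xu))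
  (λ coprime d d∣f d∣u → coprime d d∣f (∣ₚ-x* {d} {u} d∣u))

Coprimeₚ-zero⇔ : ∀ {t} → Coprimeₚ (true ∷ t) [] ⇔ t ≈ₚ []
Coprimeₚ-zero⇔ {t} = mk⇔ ⇒ ⇐
  where
  ⇒ : Coprimeₚ (true ∷ t) [] → t ≈ₚ []
  ⇒ coprime with degree-or-zero t
  ... | inj₁ t≈0      = t≈0
  ... | inj₂ (i , dt) with ∣ₚ-oneₚ⇒degree-zero {true ∷ t} (coprime (true ∷ t) (∣ₚ-refl (true ∷ t)) (∣ₚ-zero (true ∷ t))) (HasDegree-∷ {a = true} dt)
  ...   | ()
  ⇐ : t ≈ₚ [] → Coprimeₚ (true ∷ t) []
  ⇐ t≈0 d d∣f _ = ∣ₚ-respʳ {d} {true ∷ t} {oneₚ} (∷-cong t≈0) d∣f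

Coprimeₚ-ones⇔ : ∀ {t v} → Coprimeₚ (true ∷ t) (true ∷ v) ⇔ Coprimeₚ (true ∷ t) (t +ₚ v)
Coprimeₚ-ones⇔ {t} {v} = ⇔-trans (Coprimeₚ-+ₚ⇔ {true ∷ t} {true ∷ v}) (⇔-sym (Coprimeₚ-x*⇔ {true ∷ t} {t +ₚ v} refl))

length-+ₚ : ∀ p q → length p ≤ length q → length (p +ₚ q) ≡ length q
length-+ₚ []      q       _         = refl
length-+ₚ (a ∷ p) (b ∷ q) (s≤s p≤q) = cong suc (length-+ₚ p q p≤q)

-- Euclid's algorithm; the fuel bounds length t + length u, which every step decreases.
coprime? : ∀ t u → Dec (Coprimeₚ (true ∷ t) u)
coprime? t u = bounded (suc (length t + length u)) t u ≤-refl
  where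
  bounded : ∀ fuel t u → length t + length u < fuel → Dec (Coprimeₚ (true ∷ t) u)
  bounded (suc n) t []          _        = map (⇔-sym (Coprimeₚ-zero⇔ {t})) (isZero? t)
  bounded (suc n) t (false ∷ u) (s≤s lt) = map (Coprimeₚ-x*⇔ {true ∷ t} {u} refl) (bounded n t u (subst (_≤ n) (+-suc _ _) lt))
  bounded (suc n) t (true ∷ v)  (s≤s lt) with length v ≤? length t
  ... | yes v≤t = map (⇔-trans (⇔-sym (Coprimeₚ-ones⇔ {v} {t})) (Coprimeₚ-sym⇔ {true ∷ v} {true ∷ t}))
    (bounded n v (v +ₚ t) (subst (λ m → suc (length v + m) ≤ n) (sym (length-+ₚ v t v≤t))
      (subst (_≤ n) (trans (+-suc (length t) (length v)) (cong suc (+-comm (length t) (length v)))) lt)))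
  ... | no v≰t = map (⇔-sym (Coprimeₚ-ones⇔ {t} {v}))
    (bounded n t (t +ₚ v) (subst (λ m → suc (length t + m) ≤ n) (sym (length-+ₚ t v (<⇒≤ (≰⇒> v≰t))))
      (subst (_≤ n) (+-suc (length t) (length v)) lt)))

-- Counting coprime pairs

∑ : ∀ n → (Vec Bool n → ℕ) → ℕ
∑ zero    F = F []
∑ (suc n) F = ∑ n (λ s → F (false ∷ s)) + ∑ n (λ s → F (true ∷ s))

∑-cong : ∀ n {F G : Vec Bool n → ℕ} → (∀ s → F s ≡ G s) → ∑ n F ≡ ∑ n G
∑-cong zero    F≡G = F≡G []
∑-cong (suc n) F≡G = cong₂ _+_ (∑-cong n (λ s → F≡G (false ∷ s))) (∑-cong n (λ s → F≡G (true ∷ s)))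

∑-zero : ∀ n {F : Vec Bool n → ℕ} → (∀ s → F s ≡ 0) → ∑ n F ≡ 0
∑-zero zero    F≡0 = F≡0 []
∑-zero (suc n) F≡0 = cong₂ _+_ (∑-zero n (λ s → F≡0 (false ∷ s))) (∑-zero n (λ s → F≡0 (true ∷ s)))

∑-distrib-+ : ∀ n (F G : Vec Bool n → ℕ) → ∑ n (λ s → F s + G s) ≡ ∑ n F + ∑ n G
∑-distrib-+ zero    F G = refl
∑-distrib-+ (suc n) F G = trans
  (cong₂ _+_ (∑-distrib-+ n (λ s → F (false ∷ s)) (λ s → G (false ∷ s))) (∑-distrib-+ n (λ s → F (true ∷ s)) (λ s → G (true ∷ s))))
  (+-interchange (∑ n (λ s → F (false ∷ s))) _ _ _)

∑-comm : ∀ a b (F : Vec Bool a → Vec Bool b → ℕ) → ∑ a (λ s → ∑ b (F s)) ≡ ∑ b (λ t → ∑ a (λ s → F s t))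
∑-comm zero    b F = refl
∑-comm (suc a) b F = trans
  (cong₂ _+_ (∑-comm a b (λ s → F (false ∷ s))) (∑-comm a b (λ s → F (true ∷ s))))
  (sym (∑-distrib-+ b _ _))

_⊕_ : ∀ {n} → Vec Bool n → Vec Bool n → Vec Bool n
_⊕_ = zipWith _xor_

∑-⊕ : ∀ n (F : Vec Bool n → ℕ) (w : Vec Bool n) → ∑ n (λ s → F (s ⊕ w)) ≡ ∑ n F
∑-⊕ zero    F []          = refl
∑-⊕ (suc n) F (false ∷ w) = cong₂ _+_ (∑-⊕ n (λ s → F (false ∷ s)) w) (∑-⊕ n (λ s → F (true ∷ s)) w)
∑-⊕ (suc n) F (true ∷ w)  = trans
  (cong₂ _+_ (∑-⊕ n (λ s → F (true ∷ s)) w) (∑-⊕ n (λ s → F (false ∷ s)) w))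
  (+-comm (∑ n (λ s → F (true ∷ s))) _)

∑-∷ʳ : ∀ n (F : Vec Bool (suc n) → ℕ) → ∑ (suc n) F ≡ ∑ n (λ s → F (s ∷ʳ false)) + ∑ n (λ s → F (s ∷ʳ true))
∑-∷ʳ zero    F = refl
∑-∷ʳ (suc n) F = trans
  (cong₂ _+_ (∑-∷ʳ n (λ s → F (false ∷ s))) (∑-∷ʳ n (λ s → F (true ∷ s))))
  (+-interchange (∑ n (λ s → F (false ∷ (s ∷ʳ false)))) _ _ _)

∑-framed : ∀ n (F : Vec Bool (suc (suc n)) → ℕ) →
  (∀ s → F (false ∷ s) ≡ 0) → (∀ s → F (true ∷ (s ∷ʳ false)) ≡ 0) →
  ∑ (suc (suc n)) F ≡ ∑ n (λ s → F (true ∷ (s ∷ʳ true)))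
∑-framed n F F₀≡0 Fₙ≡0 = begin
  ∑ (suc n) (λ s → F (false ∷ s)) + ∑ (suc n) (λ s → F (true ∷ s))
    ≡⟨ cong (_+ ∑ (suc n) (λ s → F (true ∷ s))) (∑-zero (suc n) F₀≡0) ⟩
  ∑ (suc n) (λ s → F (true ∷ s))
    ≡⟨ ∑-∷ʳ n (λ s → F (true ∷ s)) ⟩
  ∑ n (λ s → F (true ∷ (s ∷ʳ false))) + ∑ n (λ s → F (true ∷ (s ∷ʳ true)))
    ≡⟨ cong (_+ ∑ n (λ s → F (true ∷ (s ∷ʳ true)))) (∑-zero n Fₙ≡0) ⟩
  ∑ n (λ s → F (true ∷ (s ∷ʳ true)))
    ∎

χ : ∀ {P : Set} → Dec P → ℕ
χ (yes _) = 1
χ (no _)  = 0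

χ-cong : ∀ {P Q : Set} → P ⇔ Q → (P? : Dec P) (Q? : Dec Q) → χ P? ≡ χ Q?
χ-cong P⇔Q (yes _) (yes _) = refl
χ-cong P⇔Q (yes p) (no ¬q) = ⊥-elim (¬q (to P⇔Q p))
χ-cong P⇔Q (no ¬p) (yes q) = ⊥-elim (¬p (from P⇔Q q))
χ-cong P⇔Q (no _)  (no _)  = refl

χ-reject : ∀ {P : Set} → ¬ P → (P? : Dec P) → χ P? ≡ 0
χ-reject ¬p (yes p) = ⊥-elim (¬p p)
χ-reject ¬p (no _)  = refl

coprimeχ : Poly → Poly → ℕ
coprimeχ t u = χ (coprime? t u)

coprimeχ-cong : ∀ t u t′ u′ → Coprimeₚ (true ∷ t) u ⇔ Coprimeₚ (true ∷ t′) u′ → coprimeχ t u ≡ coprimeχ t′ u′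
coprimeχ-cong t u t′ u′ eq = χ-cong eq (coprime? t u) (coprime? t′ u′)

onesχ : ∀ {a b} → Vec Bool a → Vec Bool b → ℕ
onesχ s t = coprimeχ (toList s) (true ∷ toList t)

-- E(a, b) and D(b, a); a vector s : Vec Bool a stands for the polynomial with coefficient list s.
coprimeOnes : ℕ → ℕ → ℕ
coprimeOnes a b = ∑ a λ s → ∑ b λ t → onesχ s t

coprimeOneAny : ℕ → ℕ → ℕ
coprimeOneAny b a = ∑ b λ t → ∑ a λ u → coprimeχ (toList t) (toList u)

∑-χ-isZero : ∀ n → ∑ n (λ t → χ (isZero? (toList t))) ≡ 1
∑-χ-isZero zero    = refl
∑-χ-isZero (suc n) = cong₂ _+_
  (trans (∑-cong n (λ t → χ-cong x*-isZero⇔ (isZero? (false ∷ toList t)) (isZero? (toList t)))) (∑-χ-isZero n))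
  (∑-zero n (λ t → χ-reject (λ t≈0 → true≢false (t≈0 0)) (isZero? (true ∷ toList t))))
  where
  x*-isZero⇔ : ∀ {p} → (false ∷ p) ≈ₚ [] ⇔ p ≈ₚ []
  x*-isZero⇔ = mk⇔ (λ xp≈0 i → xp≈0 (suc i)) λ where
    p≈0 zero    → refl
    p≈0 (suc i) → p≈0 i

coprimeOneAny-zero : ∀ b → coprimeOneAny b 0 ≡ 1
coprimeOneAny-zero b = trans
  (∑-cong b (λ t → χ-cong (Coprimeₚ-zero⇔ {toList t}) (coprime? (toList t) []) (isZero? (toList t))))
  (∑-χ-isZero b)

coprimeOneAny-suc : ∀ b a → coprimeOneAny b (suc a) ≡ coprimeOneAny b a + coprimeOnes b a
coprimeOneAny-suc b a = trans
  (∑-cong b λ t → cong (_+ ∑ a (onesχ t))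
    (∑-cong a λ u → coprimeχ-cong (toList t) (false ∷ toList u) (toList t) (toList u) (⇔-sym (Coprimeₚ-x*⇔ {true ∷ toList t} {toList u} refl))))
  (∑-distrib-+ b _ _)

coprimeOnes-comm : ∀ a b → coprimeOnes a b ≡ coprimeOnes b a
coprimeOnes-comm a b = trans (∑-comm a b onesχ)
  (∑-cong b λ t → ∑-cong a λ s → coprimeχ-cong (toList s) (true ∷ toList t) (toList t) (true ∷ toList s) (Coprimeₚ-sym⇔ {true ∷ toList s} {true ∷ toList t}))

toList-padRight : ∀ {b a} (b≤a : b ≤ a) (t : Vec Bool b) → toList (padRight b≤a false t) ≈ₚ toList t
toList-padRight {a = a} z≤n []      i       = coeff-zeros a i
  where
  coeff-zeros : ∀ n i → coeff (toList (replicate n false)) i ≡ false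
  coeff-zeros zero    i       = refl
  coeff-zeros (suc n) zero    = refl
  coeff-zeros (suc n) (suc i) = coeff-zeros n i
toList-padRight (s≤s b≤a) (x ∷ t) zero    = refl
toList-padRight (s≤s b≤a) (x ∷ t) (suc i) = toList-padRight b≤a t i

coeff-⊕ : ∀ {n} (s w : Vec Bool n) i → coeff (toList (s ⊕ w)) i ≡ coeff (toList s) i xor coeff (toList w) i
coeff-⊕ []      []      i       = refl
coeff-⊕ (x ∷ s) (y ∷ w) zero    = refl
coeff-⊕ (x ∷ s) (y ∷ w) (suc i) = coeff-⊕ s w i

-- b ≤ a lets t be padded to length a, so that s ↦ s ⊕ t permutes Vec Bool a.
coprimeOnes≡coprimeOneAny : ∀ a b → b ≤ a → coprimeOnes a b ≡ coprimeOneAny b a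
coprimeOnes≡coprimeOneAny a b b≤a = trans (∑-comm a b onesχ) (∑-cong b λ t →
  trans (∑-cong a (λ s → reduce t s)) (∑-⊕ a (λ u → coprimeχ (toList t) (toList u)) (padRight b≤a false t)))
  where
  reduce : ∀ (t : Vec Bool b) (s : Vec Bool a) → onesχ s t ≡ coprimeχ (toList t) (toList (s ⊕ padRight b≤a false t))
  reduce t s = coprimeχ-cong (toList s) (true ∷ toList t) (toList t) (toList (s ⊕ padRight b≤a false t))
    (⇔-trans (Coprimeₚ-sym⇔ {true ∷ toList s} {true ∷ toList t})
    (⇔-trans (Coprimeₚ-ones⇔ {toList t} {toList s})
             (Coprimeₚ-respʳ⇔ {true ∷ toList t} {toList t +ₚ toList s} {toList (s ⊕ padRight b≤a false t)} t+s≈s⊕t)))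
    where
    t+s≈s⊕t : (toList t +ₚ toList s) ≈ₚ toList (s ⊕ padRight b≤a false t)
    t+s≈s⊕t i = begin
      coeff (toList t +ₚ toList s) i                  ≡⟨ coeff-+ₚ (toList t) (toList s) i ⟩
      coeff (toList t) i xor coeff (toList s) i       ≡⟨ xor-comm (coeff (toList t) i) _ ⟩
      coeff (toList s) i xor coeff (toList t) i       ≡⟨ cong (coeff (toList s) i xor_) (sym (toList-padRight b≤a t i)) ⟩
      coeff (toList s) i xor coeff (toList (padRight b≤a false t)) i ≡⟨ sym (coeff-⊕ s _ i) ⟩
      coeff (toList (s ⊕ padRight b≤a false t)) i     ∎

coprimeOnes-sucˡ-double : ∀ b c → c ≤ b → coprimeOnes (suc b) c ≡ coprimeOnes b c + coprimeOnes b c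
coprimeOnes-sucˡ-double b c c≤b = begin
  coprimeOnes (suc b) c               ≡⟨ coprimeOnes≡coprimeOneAny (suc b) c (≤-trans c≤b (n≤1+n b)) ⟩
  coprimeOneAny c (suc b)             ≡⟨ coprimeOneAny-suc c b ⟩
  coprimeOneAny c b + coprimeOnes c b ≡⟨ cong₂ _+_ (sym (coprimeOnes≡coprimeOneAny b c c≤b)) (coprimeOnes-comm c b) ⟩
  coprimeOnes b c + coprimeOnes b c   ∎

coprimeOneAny-sucˡ-double : ∀ b a → a ≤ suc b → coprimeOneAny (suc b) a + 1 ≡ coprimeOneAny b a + coprimeOneAny b a
coprimeOneAny-sucˡ-double b zero    _         =
  trans (cong (_+ 1) (coprimeOneAny-zero (suc b))) (sym (cong₂ _+_ (coprimeOneAny-zero b) (coprimeOneAny-zero b)))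
coprimeOneAny-sucˡ-double b (suc a) (s≤s a≤b) = begin
  coprimeOneAny (suc b) (suc a) + 1
    ≡⟨ cong (_+ 1) (coprimeOneAny-suc (suc b) a) ⟩
  coprimeOneAny (suc b) a + coprimeOnes (suc b) a + 1
    ≡⟨ +-rightComm (coprimeOneAny (suc b) a) _ 1 ⟩
  (coprimeOneAny (suc b) a + 1) + coprimeOnes (suc b) a
    ≡⟨ cong₂ _+_ (coprimeOneAny-sucˡ-double b a (≤-trans a≤b (n≤1+n b))) (coprimeOnes-sucˡ-double b a a≤b) ⟩
  (coprimeOneAny b a + coprimeOneAny b a) + (coprimeOnes b a + coprimeOnes b a)
    ≡⟨ +-interchange (coprimeOneAny b a) _ _ _ ⟩
  (coprimeOneAny b a + coprimeOnes b a) + (coprimeOneAny b a + coprimeOnes b a)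
    ≡⟨ sym (cong₂ _+_ (coprimeOneAny-suc b a) (coprimeOneAny-suc b a)) ⟩
  coprimeOneAny b (suc a) + coprimeOneAny b (suc a)
    ∎

coprimeOnes-diagonal-suc : ∀ n → coprimeOnes (suc n) (suc n) + 1 ≡ 4 * coprimeOnes n n
coprimeOnes-diagonal-suc n = begin
  coprimeOnes (suc n) (suc n) + 1
    ≡⟨ cong (_+ 1) (trans (coprimeOnes≡coprimeOneAny (suc n) (suc n) ≤-refl) (coprimeOneAny-suc (suc n) n)) ⟩
  coprimeOneAny (suc n) n + coprimeOnes (suc n) n + 1
    ≡⟨ +-rightComm (coprimeOneAny (suc n) n) _ 1 ⟩
  (coprimeOneAny (suc n) n + 1) + coprimeOnes (suc n) n
    ≡⟨ cong₂ _+_ (coprimeOneAny-sucˡ-double n n (n≤1+n n)) (coprimeOnes-sucˡ-double n n ≤-refl) ⟩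
  (coprimeOneAny n n + coprimeOneAny n n) + (e + e)
    ≡⟨ cong (λ d → (d + d) + (e + e)) (sym (coprimeOnes≡coprimeOneAny n n ≤-refl)) ⟩
  (e + e) + (e + e)
    ≡⟨ four-times e ⟩
  4 * e
    ∎
  where
  e = coprimeOnes n n
  four-times : ∀ x → (x + x) + (x + x) ≡ 4 * x
  four-times = solve-∀

leadingOnes : ℕ → ℕ → ℕ
leadingOnes a b = ∑ a λ s → ∑ b λ t → onesχ (s ∷ʳ true) t

exactOnes : ℕ → ℕ → ℕ
exactOnes a b = ∑ a λ s → ∑ b λ t → onesχ (s ∷ʳ true) (t ∷ʳ true)

toList-∷ʳ-false : ∀ {n} (s : Vec Bool n) → toList (s ∷ʳ false) ≈ₚ toList s
toList-∷ʳ-false []      zero    = refl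
toList-∷ʳ-false []      (suc i) = refl
toList-∷ʳ-false (x ∷ s) zero    = refl
toList-∷ʳ-false (x ∷ s) (suc i) = toList-∷ʳ-false s i

onesχ-∷ʳ-falseˡ : ∀ {a b} (s : Vec Bool a) (t : Vec Bool b) → onesχ (s ∷ʳ false) t ≡ onesχ s t
onesχ-∷ʳ-falseˡ s t = coprimeχ-cong (toList (s ∷ʳ false)) (true ∷ toList t) (toList s) (true ∷ toList t)
  (Coprimeₚ-respˡ⇔ {true ∷ toList (s ∷ʳ false)} {true ∷ toList s} {true ∷ toList t} (∷-cong (toList-∷ʳ-false s)))

onesχ-∷ʳ-falseʳ : ∀ {a b} (s : Vec Bool a) (t : Vec Bool b) → onesχ s (t ∷ʳ false) ≡ onesχ s t
onesχ-∷ʳ-falseʳ s t = coprimeχ-cong (toList s) (true ∷ toList (t ∷ʳ false)) (toList s) (true ∷ toList t)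
  (Coprimeₚ-respʳ⇔ {true ∷ toList s} {true ∷ toList (t ∷ʳ false)} {true ∷ toList t} (∷-cong (toList-∷ʳ-false t)))

coprimeOnes-sucˡ-leading : ∀ a b → coprimeOnes (suc a) b ≡ coprimeOnes a b + leadingOnes a b
coprimeOnes-sucˡ-leading a b = trans (∑-∷ʳ a (λ s → ∑ b (onesχ s)))
  (cong (_+ leadingOnes a b) (∑-cong a λ s → ∑-cong b λ t → onesχ-∷ʳ-falseˡ s t))

leadingOnes-sucʳ-exact : ∀ a b → leadingOnes a (suc b) ≡ leadingOnes a b + exactOnes a b
leadingOnes-sucʳ-exact a b = trans
  (∑-cong a λ s → trans (∑-∷ʳ b (onesχ (s ∷ʳ true)))
    (cong (_+ ∑ b (λ t → onesχ (s ∷ʳ true) (t ∷ʳ true))) (∑-cong b λ t → onesχ-∷ʳ-falseʳ (s ∷ʳ true) t)))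
  (∑-distrib-+ a _ _)

-- Inclusion–exclusion over the top coefficients.
exactOnes-diagonal : ∀ n → exactOnes n n + 1 ≡ coprimeOnes n n
exactOnes-diagonal n = +-cancelˡ-≡ (3 * e) _ _ (begin
  3 * e + (exactOnes n n + 1)                  ≡⟨ rearrange e (exactOnes n n) ⟩
  (e + e) + (e + exactOnes n n) + 1            ≡⟨ cong (_+ 1) (sym top-split) ⟩
  coprimeOnes (suc n) (suc n) + 1              ≡⟨ coprimeOnes-diagonal-suc n ⟩
  4 * e                                        ≡⟨ four-times e ⟩
  3 * e + e                                    ∎)
  where
  e = coprimeOnes n n
  leading≡e : leadingOnes n n ≡ e
  leading≡e = +-cancelˡ-≡ e _ _ (trans (sym (coprimeOnes-sucˡ-leading n n)) (coprimeOnes-sucˡ-double n n ≤-refl))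
  top-split : coprimeOnes (suc n) (suc n) ≡ (e + e) + (e + exactOnes n n)
  top-split = begin
    coprimeOnes (suc n) (suc n)                     ≡⟨ coprimeOnes-sucˡ-leading n (suc n) ⟩
    coprimeOnes n (suc n) + leadingOnes n (suc n)   ≡⟨ cong₂ _+_ (trans (coprimeOnes-comm n (suc n)) (coprimeOnes-sucˡ-double n n ≤-refl))
                                                                  (leadingOnes-sucʳ-exact n n) ⟩
    (e + e) + (leadingOnes n n + exactOnes n n)     ≡⟨ cong (λ l → (e + e) + (l + exactOnes n n)) leading≡e ⟩
    (e + e) + (e + exactOnes n n)                   ∎
  rearrange : ∀ x y → 3 * x + (y + 1) ≡ (x + x) + (x + y) + 1
  rearrange = solve-∀
  four-times : ∀ x → 4 * x ≡ 3 * x + x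
  four-times = solve-∀

coeff-beyond : ∀ {k} (u : Vec Bool k) i → k ≤ i → coeff (toList u) i ≡ false
coeff-beyond []      i       _         = refl
coeff-beyond (x ∷ u) (suc i) (s≤s k≤i) = coeff-beyond u i k≤i

coeff-last : ∀ {n} (s : Vec Bool n) x → coeff (toList (s ∷ʳ x)) n ≡ x
coeff-last []      x = refl
coeff-last (y ∷ s) x = coeff-last s x

HasDegree? : ∀ m (u : Vec Bool (suc m)) → Dec (HasDegree m (toList u))
HasDegree? m u = map (mk⇔ (λ top → top , λ i m<i → coeff-beyond u i m<i) proj₁) (coeff (toList u) m Bool.≟ true)

good? : ∀ m p → Dec (Good m p)
good? m (u , v) = HasDegree? m u ×-dec (HasDegree? m v ×-dec constOnesCoprime? u v)
  where
  constOnesCoprime? : ∀ {k} (u v : Vec Bool k) →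
    Dec (ConstOne (toList u) × ConstOne (toList v) × Coprimeₚ (toList u) (toList v))
  constOnesCoprime? []          _           = no λ ()
  constOnesCoprime? (false ∷ s) _           = no λ ()
  constOnesCoprime? (true ∷ s)  (false ∷ t) = no λ { (_ , () , _) }
  constOnesCoprime? (true ∷ s)  (true ∷ t)  =
    map (mk⇔ (λ coprime → refl , refl , coprime) (λ (_ , _ , coprime) → coprime)) (coprime? (toList s) (true ∷ toList t))

Good-framed⇔ : ∀ n (s t : Vec Bool n) →
  Good (suc n) (true ∷ (s ∷ʳ true) , true ∷ (t ∷ʳ true)) ⇔ Coprimeₚ (true ∷ toList (s ∷ʳ true)) (true ∷ toList (t ∷ʳ true))
Good-framed⇔ n s t = mk⇔ (λ (_ , _ , _ , _ , coprime) → coprime)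
  (λ coprime → degree s , degree t , refl , refl , coprime)
  where
  degree : ∀ (s : Vec Bool n) → HasDegree (suc n) (toList (true ∷ (s ∷ʳ true)))
  degree s = coeff-last s true , λ i n<i → coeff-beyond (true ∷ (s ∷ʳ true)) i n<i

goodCount : ℕ → ℕ
goodCount n = ∑ (suc (suc n)) λ u → ∑ (suc (suc n)) λ v → χ (good? (suc n) (u , v))

goodCount≡exactOnes : ∀ n → goodCount n ≡ exactOnes n n
goodCount≡exactOnes n = trans
  (∑-framed n (λ u → ∑ (suc (suc n)) (goodχ u))
    (λ s → ∑-zero (suc (suc n)) λ v → χ-reject (λ { (_ , _ , () , _) }) (good? (suc n) (false ∷ s , v)))
    (λ s → ∑-zero (suc (suc n)) λ v → χ-reject (λ (du , _) → low-degree s (proj₁ du)) (good? (suc n) (true ∷ (s ∷ʳ false) , v))))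
  (∑-cong n λ s → trans
    (∑-framed n (goodχ (true ∷ (s ∷ʳ true)))
      (λ t → χ-reject (λ { (_ , _ , _ , () , _) }) (good? (suc n) (true ∷ (s ∷ʳ true) , false ∷ t)))
      (λ t → χ-reject (λ (_ , dv , _) → low-degree t (proj₁ dv)) (good? (suc n) (true ∷ (s ∷ʳ true) , true ∷ (t ∷ʳ false)))))
    (∑-cong n λ t → χ-cong (Good-framed⇔ n s t)
      (good? (suc n) (true ∷ (s ∷ʳ true) , true ∷ (t ∷ʳ true))) (coprime? (toList (s ∷ʳ true)) (true ∷ toList (t ∷ʳ true)))))
  where
  goodχ : Vec Bool (suc (suc n)) → Vec Bool (suc (suc n)) → ℕ
  goodχ u v = χ (good? (suc n) (u , v))
  low-degree : ∀ (s : Vec Bool n) → coeff (toList (s ∷ʳ false)) n ≡ true → ⊥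
  low-degree s top = true≢false (trans (sym top) (coeff-last s false))

-- Enumerating the pairs

allVecs : ∀ n → List (Vec Bool n)
allVecs zero    = [] ∷ []
allVecs (suc n) = cartesianProductWith _∷_ (false ∷ true ∷ []) (allVecs n)

allVecs-unique : ∀ n → Unique (allVecs n)
allVecs-unique zero    = [] ∷ []
allVecs-unique (suc n) = cartesianProductWith⁺ {xs = false ∷ true ∷ []} _∷_ ∷-injective (((λ ()) ∷ []) ∷ [] ∷ []) (allVecs-unique n)
  where
  ∷-injective : ∀ {x y : Bool} {s t : Vec Bool n} → x ∷ s ≡ y ∷ t → x ≡ y × s ≡ t
  ∷-injective refl = refl , refl

allVecs-complete : ∀ {n} (s : Vec Bool n) → s ∈ allVecs n
allVecs-complete []          = here refl
allVecs-complete (false ∷ s) = ∈-cartesianProductWith⁺ _∷_ {xs = false ∷ true ∷ []} (here refl) (allVecs-complete s)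
allVecs-complete (true ∷ s)  = ∈-cartesianProductWith⁺ _∷_ {xs = false ∷ true ∷ []} (there (here refl)) (allVecs-complete s)

sum-cartesianProductWith : ∀ {A B C : Set} (h : C → ℕ) (f : A → B → C) xs ys →
  sum (List.map h (cartesianProductWith f xs ys)) ≡ sum (List.map (λ x → sum (List.map (λ y → h (f x y)) ys)) xs)
sum-cartesianProductWith h f []       ys = refl
sum-cartesianProductWith h f (x ∷ xs) ys = begin
  sum (List.map h (List.map (f x) ys ++ cartesianProductWith f xs ys))
    ≡⟨ cong sum (map-++ h (List.map (f x) ys) _) ⟩
  sum (List.map h (List.map (f x) ys) ++ List.map h (cartesianProductWith f xs ys))
    ≡⟨ sum-++ (List.map h (List.map (f x) ys)) _ ⟩
  sum (List.map h (List.map (f x) ys)) + sum (List.map h (cartesianProductWith f xs ys))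
    ≡⟨ cong₂ _+_ (cong sum (sym (map-∘ ys))) (sum-cartesianProductWith h f xs ys) ⟩
  sum (List.map (λ y → h (f x y)) ys) + sum (List.map (λ x → sum (List.map (λ y → h (f x y)) ys)) xs)
    ∎

∑≡sum-allVecs : ∀ n (F : Vec Bool n → ℕ) → ∑ n F ≡ sum (List.map F (allVecs n))
∑≡sum-allVecs zero    F = sym (+-identityʳ (F []))
∑≡sum-allVecs (suc n) F = trans
  (cong₂ _+_ (∑≡sum-allVecs n (λ s → F (false ∷ s))) (trans (∑≡sum-allVecs n (λ s → F (true ∷ s))) (sym (+-identityʳ _))))
  (sym (sum-cartesianProductWith F _∷_ (false ∷ true ∷ []) (allVecs n)))

length-filter≡sum-χ : ∀ {A : Set} {P : A → Set} (P? : ∀ x → Dec (P x)) xs →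
  length (filter P? xs) ≡ sum (List.map (λ x → χ (P? x)) xs)
length-filter≡sum-χ P? []       = refl
length-filter≡sum-χ P? (x ∷ xs) with P? x
... | yes _ = cong suc (length-filter≡sum-χ P? xs)
... | no _  = length-filter≡sum-χ P? xs

∑∑≡sum-cartesianProduct : ∀ a b (F : Vec Bool a → Vec Bool b → ℕ) →
  ∑ a (λ u → ∑ b (F u)) ≡ sum (List.map (λ (u , v) → F u v) (cartesianProduct (allVecs a) (allVecs b)))
∑∑≡sum-cartesianProduct a b F = begin
  ∑ a (λ u → ∑ b (F u))
    ≡⟨ ∑≡sum-allVecs a _ ⟩
  sum (List.map (λ u → ∑ b (F u)) (allVecs a))
    ≡⟨ cong sum (map-cong (λ u → ∑≡sum-allVecs b (F u)) (allVecs a)) ⟩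
  sum (List.map (λ u → sum (List.map (F u) (allVecs b))) (allVecs a))
    ≡⟨ sym (sum-cartesianProductWith (λ (u , v) → F u v) _,_ (allVecs a) (allVecs b)) ⟩
  sum (List.map (λ (u , v) → F u v) (cartesianProduct (allVecs a) (allVecs b)))
    ∎

countIs-goodCount : ∀ n → CountIs (suc n) (goodCount n)
countIs-goodCount n = filter (good? (suc n)) pairs
  , filter⁺ (good? (suc n)) (cartesianProduct⁺ (allVecs-unique (suc (suc n))) (allVecs-unique (suc (suc n))))
  , (λ (u , v) → mk⇔ (λ p∈ → proj₂ (∈-filter⁻ (good? (suc n)) {xs = pairs} p∈))
                      (∈-filter⁺ (good? (suc n)) (∈-cartesianProduct⁺ (allVecs-complete u) (allVecs-complete v))))
  , trans (length-filter≡sum-χ (good? (suc n)) pairs)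
          (sym (∑∑≡sum-cartesianProduct (suc (suc n)) (suc (suc n)) λ u v → χ (good? (suc n) (u , v))))
  where
  pairs = cartesianProduct (allVecs (suc (suc n))) (allVecs (suc (suc n)))

repunit₄ : ℕ → ℕ
repunit₄ zero    = 0
repunit₄ (suc n) = 4 * repunit₄ n + 1

repunit₄-closed : ∀ n → 3 * repunit₄ n + 1 ≡ 4 ^ n
repunit₄-closed zero    = refl
repunit₄-closed (suc n) = trans (step (repunit₄ n)) (cong (4 *_) (repunit₄-closed n))
  where
  step : ∀ x → 3 * (4 * x + 1) + 1 ≡ 4 * (3 * x + 1)
  step = solve-∀

coprimeOnes-diagonal≡repunit₄ : ∀ n → coprimeOnes n n ≡ 2 * repunit₄ n + 1
coprimeOnes-diagonal≡repunit₄ zero    = refl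
coprimeOnes-diagonal≡repunit₄ (suc n) = +-cancelʳ-≡ 1 _ _ (begin
  coprimeOnes (suc n) (suc n) + 1 ≡⟨ coprimeOnes-diagonal-suc n ⟩
  4 * coprimeOnes n n             ≡⟨ cong (4 *_) (coprimeOnes-diagonal≡repunit₄ n) ⟩
  4 * (2 * repunit₄ n + 1)        ≡⟨ step (repunit₄ n) ⟩
  2 * repunit₄ (suc n) + 1 + 1    ∎)
  where
  step : ∀ x → 4 * (2 * x + 1) ≡ 2 * (4 * x + 1) + 1 + 1
  step = solve-∀

goodCount≡2*repunit₄ : ∀ n → goodCount n ≡ 2 * repunit₄ n
goodCount≡2*repunit₄ n = +-cancelʳ-≡ 1 _ _ (begin
  goodCount n + 1       ≡⟨ cong (_+ 1) (goodCount≡exactOnes n) ⟩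
  exactOnes n n + 1     ≡⟨ exactOnes-diagonal n ⟩
  coprimeOnes n n       ≡⟨ coprimeOnes-diagonal≡repunit₄ n ⟩
  2 * repunit₄ n + 1    ∎)

pos-^ : ∀ a k → (+ a) ℤ.^ k ≡ + (a ^ k)
pos-^ a zero    = refl
pos-^ a (suc k) = trans (cong (+ a ℤ.*_) (pos-^ a k)) (sym (ℤ.pos-* a (a ^ k)))

/3-exact : ∀ q → + (q * 3) ℤ./ + 3 ≡ + q
/3-exact q = trans (div-pos-is-/ℕ (+ (q * 3)) 3) (cong +_ (m*n/n≡m q 3))

4^-1≡repunit₄*3 : ∀ m → (+ 4) ℤ.^ m ℤ.- + 1 ≡ + (repunit₄ m * 3)
4^-1≡repunit₄*3 m = begin
  (+ 4) ℤ.^ m ℤ.- + 1                 ≡⟨ cong (ℤ._- + 1) (trans (pos-^ 4 m) (cong +_ (sym (repunit₄-closed m)))) ⟩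
  + (3 * repunit₄ m + 1) ℤ.- + 1      ≡⟨ cong (ℤ._- + 1) (ℤ.pos-+ (3 * repunit₄ m) 1) ⟩
  + (3 * repunit₄ m) ℤ.+ + 1 ℤ.- + 1  ≡⟨ cancel-1 (+ (3 * repunit₄ m)) ⟩
  + (3 * repunit₄ m)                  ≡⟨ cong +_ (*-comm 3 (repunit₄ m)) ⟩
  + (repunit₄ m * 3)                  ∎
  where
  cancel-1 : ∀ z → z ℤ.+ + 1 ℤ.- + 1 ≡ z
  cancel-1 = ℤ-RingSolver.solve-∀

closedForm-repunit₄ : ∀ m → closedForm (suc m) ≡ + (2 * repunit₄ m)
closedForm-repunit₄ m = begin
  + 2 ℤ.* (((+ 4) ℤ.^ m ℤ.- + 1) ℤ./ + 3) ≡⟨ cong (λ z → + 2 ℤ.* (z ℤ./ + 3)) (4^-1≡repunit₄*3 m) ⟩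
  + 2 ℤ.* (+ (repunit₄ m * 3) ℤ./ + 3)    ≡⟨ cong (+ 2 ℤ.*_) (/3-exact (repunit₄ m)) ⟩
  + 2 ℤ.* + repunit₄ m                    ≡⟨ sym (ℤ.pos-* 2 (repunit₄ m)) ⟩
  + (2 * repunit₄ m)                      ∎

-- The middle sum

Jℕ : ℕ → ℕ
Jℕ zero          = 1
Jℕ (suc zero)    = 0
Jℕ (suc (suc k)) = Jℕ (suc k) + 2 * Jℕ k

J-numerator : ℕ → ℤ
J-numerator k = (+ 2) ℤ.^ k ℤ.+ (+ 2) ℤ.* (-1ℤ ℤ.^ k)

J-numerator≡Jℕ*3 : ∀ k → J-numerator k ≡ + (Jℕ k * 3)
J-numerator≡Jℕ*3 zero          = refl
J-numerator≡Jℕ*3 (suc zero)    = refl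
J-numerator≡Jℕ*3 (suc (suc k)) = begin
  J-numerator (suc (suc k))                              ≡⟨ recurrence ((+ 2) ℤ.^ k) (-1ℤ ℤ.^ k) ⟩
  J-numerator (suc k) ℤ.+ + 2 ℤ.* J-numerator k          ≡⟨ cong₂ (λ a b → a ℤ.+ + 2 ℤ.* b) (J-numerator≡Jℕ*3 (suc k)) (J-numerator≡Jℕ*3 k) ⟩
  + (Jℕ (suc k) * 3) ℤ.+ + 2 ℤ.* + (Jℕ k * 3)            ≡⟨ cong (λ z → + (Jℕ (suc k) * 3) ℤ.+ z) (sym (ℤ.pos-* 2 (Jℕ k * 3))) ⟩
  + (Jℕ (suc k) * 3) ℤ.+ + (2 * (Jℕ k * 3))              ≡⟨ sym (ℤ.pos-+ (Jℕ (suc k) * 3) _) ⟩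
  + (Jℕ (suc k) * 3 + 2 * (Jℕ k * 3))                    ≡⟨ cong +_ (factor (Jℕ (suc k)) (Jℕ k)) ⟩
  + (Jℕ (suc (suc k)) * 3)                               ∎
  where
  recurrence : ∀ A S → + 2 ℤ.* (+ 2 ℤ.* A) ℤ.+ + 2 ℤ.* (-1ℤ ℤ.* (-1ℤ ℤ.* S))
                     ≡ (+ 2 ℤ.* A ℤ.+ + 2 ℤ.* (-1ℤ ℤ.* S)) ℤ.+ + 2 ℤ.* (A ℤ.+ + 2 ℤ.* S)
  recurrence = ℤ-RingSolver.solve-∀
  factor : ∀ a b → a * 3 + 2 * (b * 3) ≡ (a + 2 * b) * 3
  factor = solve-∀

J≡Jℕ : ∀ k → J k ≡ + Jℕ k
J≡Jℕ k = trans (cong (ℤ._/ + 3) (J-numerator≡Jℕ*3 k)) (/3-exact (Jℕ k))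

3*J≡J-numerator : ∀ k → + 3 ℤ.* J k ≡ J-numerator k
3*J≡J-numerator k = begin
  + 3 ℤ.* J k       ≡⟨ cong (+ 3 ℤ.*_) (J≡Jℕ k) ⟩
  + 3 ℤ.* + Jℕ k    ≡⟨ sym (ℤ.pos-* 3 (Jℕ k)) ⟩
  + (3 * Jℕ k)      ≡⟨ cong +_ (*-comm 3 (Jℕ k)) ⟩
  + (Jℕ k * 3)      ≡⟨ sym (J-numerator≡Jℕ*3 k) ⟩
  J-numerator k     ∎

^ˢ≡^ : ∀ x n → x ^ˢ n ≡ x ℤ.^ n
^ˢ≡^ x zero    = refl
^ˢ≡^ x (suc n) = cong (x ℤ.*_) (^ˢ≡^ x n)

×ˢ≡* : ∀ n x → n ×ˢ x ≡ + n ℤ.* x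
×ˢ≡* zero    x = sym (ℤ.*-zeroˡ x)
×ˢ≡* (suc n) x = begin
  x ℤ.+ n ×ˢ x                ≡⟨ cong (λ z → x ℤ.+ z) (×ˢ≡* n x) ⟩
  x ℤ.+ + n ℤ.* x             ≡⟨ cong (ℤ._+ (+ n ℤ.* x)) (sym (ℤ.*-identityˡ x)) ⟩
  + 1 ℤ.* x ℤ.+ + n ℤ.* x     ≡⟨ sym (ℤ.*-distribʳ-+ x (+ 1) (+ n)) ⟩
  (+ 1 ℤ.+ + n) ℤ.* x         ≡⟨ cong (ℤ._* x) (sym (ℤ.pos-+ 1 n)) ⟩
  + suc n ℤ.* x               ∎

sumℤ-applyUpTo : ∀ (f : ℕ → ℤ) n → List.foldr ℤ._+_ 0ℤ (applyUpTo f n) ≡ sumℤ {n} (λ i → f (toℕ i))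
sumℤ-applyUpTo f zero    = refl
sumℤ-applyUpTo f (suc n) = cong (λ z → f 0 ℤ.+ z) (sumℤ-applyUpTo (λ i → f (suc i)) n)

sumℤ-scaled-difference : ∀ n c (f g : Fin n → ℤ) →
  sumℤ (λ i → c ℤ.* (f i ℤ.- g i)) ≡ c ℤ.* (sumℤ f ℤ.- sumℤ g)
sumℤ-scaled-difference zero    c f g = sym (ℤ.*-zeroʳ c)
sumℤ-scaled-difference (suc n) c f g =
  trans (cong (λ z → c ℤ.* (f zero ℤ.- g zero) ℤ.+ z) (sumℤ-scaled-difference n c (λ i → f (suc i)) (λ i → g (suc i))))
        (distrib c (f zero) (g zero) _ _)
  where
  distrib : ∀ c a b s t → c ℤ.* (a ℤ.- b) ℤ.+ c ℤ.* (s ℤ.- t) ≡ c ℤ.* ((a ℤ.+ s) ℤ.- (b ℤ.+ t))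
  distrib = ℤ-RingSolver.solve-∀

-- The summand of middleSum (m + 1) at k = i + 2.
middleTerm : ℕ → ℕ → ℤ
middleTerm m i = (+ 2) ℤ.^ (m ∸ suc i) ℤ.* + (m C (suc i)) ℤ.* J (suc (suc i))

-- With 3 J (i + 2) = 2 (2^(i+1) − (−1)^(i+1)), each term is a difference of two binomial terms.
3*middleTerm : ∀ m (i : Fin m) →
  + 3 ℤ.* middleTerm m (toℕ i) ≡ + 2 ℤ.* (binomialTerm (+ 2) (+ 2) m (suc i) ℤ.- binomialTerm -1ℤ (+ 2) m (suc i))
3*middleTerm m i = begin
  + 3 ℤ.* (P ℤ.* B ℤ.* J (suc (suc k)))
    ≡⟨ reassociate P B (J (suc (suc k))) ⟩
  P ℤ.* B ℤ.* (+ 3 ℤ.* J (suc (suc k)))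
    ≡⟨ cong (P ℤ.* B ℤ.*_) (3*J≡J-numerator (suc (suc k))) ⟩
  P ℤ.* B ℤ.* J-numerator (suc (suc k))
    ≡⟨ split P B ((+ 2) ℤ.^ k) (-1ℤ ℤ.^ k) ⟩
  + 2 ℤ.* (B ℤ.* ((+ 2) ℤ.^ suc k ℤ.* P) ℤ.- B ℤ.* (-1ℤ ℤ.^ suc k ℤ.* P))
    ≡⟨ sym (cong (λ z → + 2 ℤ.* z) (cong₂ ℤ._-_ (asBinomial (+ 2)) (asBinomial -1ℤ))) ⟩
  + 2 ℤ.* (binomialTerm (+ 2) (+ 2) m (suc i) ℤ.- binomialTerm -1ℤ (+ 2) m (suc i))
    ∎
  where
  k = toℕ i
  P = (+ 2) ℤ.^ (m ∸ suc k)
  B = + (m C (suc k))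
  asBinomial : ∀ x → binomialTerm x (+ 2) m (suc i) ≡ B ℤ.* (x ℤ.^ suc k ℤ.* P)
  asBinomial x = trans (×ˢ≡* (m C (suc k)) _) (cong (B ℤ.*_) (cong₂ ℤ._*_ (^ˢ≡^ x (suc k)) (^ˢ≡^ (+ 2) (m ∸ suc k))))
  reassociate : ∀ a b c → + 3 ℤ.* (a ℤ.* b ℤ.* c) ≡ a ℤ.* b ℤ.* (+ 3 ℤ.* c)
  reassociate = ℤ-RingSolver.solve-∀
  split : ∀ P B A S → P ℤ.* B ℤ.* (+ 2 ℤ.* (+ 2 ℤ.* A) ℤ.+ + 2 ℤ.* (-1ℤ ℤ.* (-1ℤ ℤ.* S)))
                    ≡ + 2 ℤ.* (B ℤ.* ((+ 2 ℤ.* A) ℤ.* P) ℤ.- B ℤ.* ((-1ℤ ℤ.* S) ℤ.* P))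
  split = ℤ-RingSolver.solve-∀

-- The binomial expansions of (2 + 2)^m and (−1 + 2)^m share their k = 0 term.
3*middleSum : ∀ m → + 3 ℤ.* middleSum (suc m) ≡ + 2 ℤ.* ((+ 2 ℤ.+ + 2) ^ˢ m ℤ.- (-1ℤ ℤ.+ + 2) ^ˢ m)
3*middleSum m = begin
  + 3 ℤ.* middleSum (suc m)
    ≡⟨ cong (λ l → + 3 ℤ.* List.foldr ℤ._+_ 0ℤ l) (map-upTo (middleTerm m) m) ⟩
  + 3 ℤ.* List.foldr ℤ._+_ 0ℤ (applyUpTo (middleTerm m) m)
    ≡⟨ cong (+ 3 ℤ.*_) (sumℤ-applyUpTo (middleTerm m) m) ⟩
  + 3 ℤ.* sumℤ {m} (λ i → middleTerm m (toℕ i))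
    ≡⟨ *-distribˡ-sum {m} (+ 3) (λ i → middleTerm m (toℕ i)) ⟩
  sumℤ {m} (λ i → + 3 ℤ.* middleTerm m (toℕ i))
    ≡⟨ sum-cong-≗ {m} {x = λ i → + 3 ℤ.* middleTerm m (toℕ i)} (3*middleTerm m) ⟩
  sumℤ {m} (λ i → + 2 ℤ.* (b₂ (suc i) ℤ.- b₁ (suc i)))
    ≡⟨ sumℤ-scaled-difference m (+ 2) (λ i → b₂ (suc i)) (λ i → b₁ (suc i)) ⟩
  + 2 ℤ.* (sumℤ {m} (λ i → b₂ (suc i)) ℤ.- sumℤ {m} (λ i → b₁ (suc i)))
    ≡⟨ cong (+ 2 ℤ.*_) (sym (cancel (b₂ zero) _ _)) ⟩
  + 2 ℤ.* (binomialExpansion (+ 2) (+ 2) m ℤ.- binomialExpansion -1ℤ (+ 2) m)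
    ≡⟨ sym (cong (+ 2 ℤ.*_) (cong₂ ℤ._-_ (Binomial.theorem m (+ 2) (+ 2)) (Binomial.theorem m -1ℤ (+ 2)))) ⟩
  + 2 ℤ.* ((+ 2 ℤ.+ + 2) ^ˢ m ℤ.- (-1ℤ ℤ.+ + 2) ^ˢ m)
    ∎
  where
  b₂ = binomialTerm (+ 2) (+ 2) m
  b₁ = binomialTerm -1ℤ (+ 2) m
  cancel : ∀ c s t → (c ℤ.+ s) ℤ.- (c ℤ.+ t) ≡ s ℤ.- t
  cancel = ℤ-RingSolver.solve-∀

middleSum-repunit₄ : ∀ m → middleSum (suc m) ≡ + (2 * repunit₄ m)
middleSum-repunit₄ m = ℤ.*-cancelˡ-≡ (+ 3) _ _ (begin
  + 3 ℤ.* middleSum (suc m)                               ≡⟨ 3*middleSum m ⟩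
  + 2 ℤ.* ((+ 2 ℤ.+ + 2) ^ˢ m ℤ.- (-1ℤ ℤ.+ + 2) ^ˢ m)     ≡⟨ cong (+ 2 ℤ.*_) (cong₂ ℤ._-_ (^ˢ≡^ (+ 4) m) (trans (^ˢ≡^ (+ 1) m) (ℤ.^-zeroˡ m))) ⟩
  + 2 ℤ.* ((+ 4) ℤ.^ m ℤ.- + 1)                           ≡⟨ cong (+ 2 ℤ.*_) (4^-1≡repunit₄*3 m) ⟩
  + 2 ℤ.* + (repunit₄ m * 3)                              ≡⟨ sym (ℤ.pos-* 2 (repunit₄ m * 3)) ⟩
  + (2 * (repunit₄ m * 3))                                ≡⟨ cong +_ (rearrange (repunit₄ m)) ⟩
  + (3 * (2 * repunit₄ m))                                ≡⟨ ℤ.pos-* 3 (2 * repunit₄ m) ⟩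
  + 3 ℤ.* + (2 * repunit₄ m)                              ∎)
  where
  rearrange : ∀ x → 2 * (x * 3) ≡ 3 * (2 * x)
  rearrange = solve-∀

lemma4 : (n : ℕ) → n ≥ 1 →
    Σ ℕ (λ a → CountIs n a × (+ a ≡ middleSum n) × (middleSum n ≡ closedForm n))
lemma4 (suc m) _ =
  goodCount m ,
  countIs-goodCount m ,
  trans (cong +_ (goodCount≡2*repunit₄ m)) (sym (middleSum-repunit₄ m)) ,
  trans (middleSum-repunit₄ m) (sym (closedForm-repunit₄ m))
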